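{- Let $T$ and $T'$ be rooted trees with vertex and edge labels, let $\omega:\Sigma\times\Sigma\to\mathbb{R}\cup\{ -\infty\}$ be a weight function and $p\in\mathbb{R}^{\ge 0}\cup\{\infty\}$ a distance penalty. Let $u\in V(T)$ and $v\in V(T')$, and let $L(\cdot,\cdot,\mathrm{rr})$ and $L(\cdot,\cdot,\mathrm{sk})$ be the table values defined in the context. For $t\in\{\mathrm{rr},\mathrm{sk}\}$ put $M^T_t=\max\{L(b,v,t)\mid b\in C(u)\}$ and $M^{T'}_t=\max\{L(u,c,t)\mid c\in C(v)\}$. Then $$L(u,v,\mathrm{sk})=\max\{M^T_{\mathrm{sk}},M^T_{\mathrm{rr}},M^{T'}_{\mathrm{sk}},M^{T'}_{\mathrm{rr}}\}-p.$$ Moreover, let $G=(C(u)\sqcup C(v),\,C(u)\times C(v))$ be the complete bipartite graph with edge weights $w(bc)=\max\{L(b,c,\mathrm{sk}),\ L(b,c,\mathrm{rr})+\omega(ub,vc)\}$ for $(b,c)\in C(u)\times C(v)$. Then $$L(u,v,\mathrm{rr})=\omega(u,v)+W(M),$$ where $M$ is a maximum weight matching of $G$ and $W(M)$ is the sum of the weights of its edges.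
   Context: All trees are finite. In a rooted tree, $C(x)$ denotes the set of children of $x$, and $T_x$ denotes the subtree consisting of $x$ and its descendants, rooted at $x$; $d_T(x,y)$ is the number of edges on the path between $x$ and $y$. The maximum of the empty set is $-\infty$. Topological embedding: a rooted tree $S$ is topologically embeddable in a rooted tree $T$ if there is an injective map $\psi:V(S)\to V(T)$ such that (i) if $b$ is a child of $a$ in $S$ then $\psi(b)$ is a descendant of $\psi(a)$, and (ii) for distinct children $b,c$ of $a$, the paths from $\psi(a)$ to $\psi(b)$ and from $\psi(a)$ to $\psi(c)$ have exactly $\psi(a)$ in common. A common subtree embedding (CSE) between rooted trees $T$ and $T'$ is a map $\varphi=\psi'\circ\psi^{ -1}:\psi(V(S))\to V(T')$, where $S$ is a nonempty rooted tree and $\psi,\psi'$ are topological embeddings of $S$ into $T$ and $T'$. Labels and weights: $l:V(T)\cup E(T)\to\Sigma$ and $l':V(T')\cup E(T')\to\Sigma$ are labelings; for vertices or edges $x$ of $T$ and $y$ of $T'$ write $\omega(x,y)=\omega(l(x),l'(y))$. For each edge $ab$ of $S$ ($b$ a child of $a$), the path $P$ in $T$ from $\psi(a)$ to $\psi(b)$ (length $k$) and the path $\varphi(P)$ in $T'$ from $\psi'(a)$ to $\psi'(b)$ (length $l$) are called topological paths; their weight is $\omega(e_1,e_1')$ if $k=l=1$, where $e_1,e_1'$ are the single edges of the two paths, and $-p\cdot(k+l-2)$ otherwise. The weight $W(\varphi)$ of the CSE is $\sum_{x\in\psi(V(S))}\omega(x,\varphi(x))$ plus the weights of all its topological paths.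 Table values: for $u\in V(T)$, $v\in V(T')$ and a CSE $\varphi$ between $T_u$ and $T'_v$ given by $S,\psi,\psi'$, let $x_\varphi=\psi(r(S))$ and $y_\varphi=\psi'(r(S))$. Then $L(u,v,\mathrm{rr})$ is the maximum of $W(\varphi)$ over all CSEs $\varphi$ between $T_u$ and $T'_v$ with $\varphi(u)=v$ (root-to-root), and $L(u,v,\mathrm{sk})$ is the maximum of $W(\varphi)-p\,(d_T(u,x_\varphi)+d_{T'}(v,y_\varphi))$ over all CSEs $\varphi$ between $T_u$ and $T'_v$ with $(x_\varphi,y_\varphi)\neq(u,v)$ (i.e., $u$ or $v$ is skipped, with penalty $p$ for each skipped vertex above the top mapped pair). A maximum weight matching of a weighted graph is a matching (possibly empty) whose total edge weight is maximum among all matchings. -}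

module Defs where

open import Data.Nat using (ℕ; zero; suc; _∸_) renaming (_+_ to _+ℕ_)
open import Data.Fin using (Fin; zero; suc)
open import Data.Maybe using (Maybe; just; nothing)
open import Data.Product using (Σ; _×_; _,_; ∃)
open import Data.Sum using (_⊎_; inj₁; inj₂)
open import Relation.Binary.PropositionalEquality using (_≡_; _≢_)
open import Relation.Nullary using (¬_)
open import Function using (_∘_)

-- Weight domain.  The paper uses ℝ; agda-stdlib has no reals, so we work
-- over an arbitrary totally ordered abelian group (ℝ is an instance).

record OrderedAbelianGroup : Set₁ where
  infixl 6 _+_
  infix 4 _≤_
  field
    R            : Set
    _+_          : R → R → R
    0#           : R
    -_           : R → R
    _≤_          : R → R → Set
    +-assoc      : ∀ x y z → (x + y) + z ≡ x + (y + z)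
    +-comm       : ∀ x y → x + y ≡ y + x
    +-identityˡ  : ∀ x → 0# + x ≡ x
    -‿inverseˡ   : ∀ x → (- x) + x ≡ 0#
    ≤-refl       : ∀ {x} → x ≤ x
    ≤-trans      : ∀ {x y z} → x ≤ y → y ≤ z → x ≤ z
    ≤-antisym    : ∀ {x y} → x ≤ y → y ≤ x → x ≡ y
    ≤-total      : ∀ x y → (x ≤ y) ⊎ (y ≤ x)
    +-monoˡ-≤    : ∀ z {x y} → x ≤ y → x + z ≤ y + z

module _ (G : OrderedAbelianGroup) where
  open OrderedAbelianGroup G

  data Ext : Set where
    -∞  : Ext
    fin : R → Ext

  data Pen : Set where
    ∞   : Pen
    fin : (q : R) → 0# ≤ q → Pen

  infixl 6 _⊕_
  _⊕_ : Ext → Ext → Ext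
  -∞    ⊕ y     = -∞
  fin x ⊕ -∞    = -∞
  fin x ⊕ fin y = fin (x + y)

  infix 4 _≤E_
  data _≤E_ : Ext → Ext → Set where
    -∞≤    : ∀ {y} → -∞ ≤E y
    fin≤   : ∀ {x y} → x ≤ y → fin x ≤E fin y

  maxE : Ext → Ext → Ext
  maxE -∞      y       = y
  maxE (fin x) -∞      = fin x
  maxE (fin x) (fin y) with ≤-total x y
  ... | inj₁ _ = fin y
  ... | inj₂ _ = fin x

  maxF : (n : ℕ) → (Fin n → Ext) → Ext
  maxF zero    f = -∞
  maxF (suc n) f = maxE (f zero) (maxF n (f ∘ suc))

  sumF : (n : ℕ) → (Fin n → Ext) → Ext
  sumF zero    f = fin 0#
  sumF (suc n) f = f zero ⊕ sumF n (f ∘ suc)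

  _×R_ : ℕ → R → R
  zero  ×R q = 0#
  suc n ×R q = q + (n ×R q)

  -- the value  -(n · p)  in ℝ ∪ {-∞}  (convention 0 · ∞ = 0)
  negPen : Pen → ℕ → Ext
  negPen ∞         zero    = fin 0#
  negPen ∞         (suc n) = -∞
  negPen (fin q _) n       = fin (- (n ×R q))

  IsMax : (Ext → Set) → Ext → Set
  IsMax P m = (∀ x → P x → x ≤E m) × (P m ⊎ (m ≡ -∞ × (∀ x → ¬ P x)))

-- Finite rooted trees with vertex and edge labels.
-- node a n e c : root labelled a, children c 0 … c (n-1), the edge to
-- child i labelled e i.

data Tree (Σl : Set) : Set where
  node : Σl → (n : ℕ) → (Fin n → Σl) → (Fin n → Tree Σl) → Tree Σl

module _ {Σl : Set} where

  data Pos : Tree Σl → Set where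
    here  : ∀ {a n e c} → Pos (node a n e c)
    there : ∀ {a n e c} (i : Fin n) → Pos (c i) → Pos (node a n e c)

  vlab : ∀ {t} → Pos t → Σl
  vlab {node a _ _ _} here = a
  vlab (there i p) = vlab p

  top : (t : Tree Σl) → Pos t
  top (node _ _ _ _) = here

  -- label of the edge from the parent (nothing for the root)
  inEdge : ∀ {t} → Pos t → Maybe Σl
  inEdge here = nothing
  inEdge (there {e = e} i q) with inEdge q
  ... | nothing = just (e i)
  ... | just x  = just x

  depth : ∀ {t} → Pos t → ℕ
  depth here = zero
  depth (there i p) = suc (depth p)

  data _≼_ : ∀ {t} → Pos t → Pos t → Set where
    ≼-here  : ∀ {a n e c} {q : Pos (node a n e c)} → here ≼ q
    ≼-there : ∀ {a n e c} (i : Fin n) {p q : Pos (c i)} →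
              p ≼ q → _≼_ {node a n e c} (there i p) (there i q)

-- Unlabelled rooted trees (the tree S of a common subtree embedding)

data Shape : Set where
  sh : (n : ℕ) → (Fin n → Shape) → Shape

data SPos : Shape → Set where
  root : ∀ {n c} → SPos (sh n c)
  sub  : ∀ {n c} (i : Fin n) → SPos (c i) → SPos (sh n c)

rootOf : (s : Shape) → SPos s
rootOf (sh n c) = root

data IsChild : ∀ {s} → SPos s → SPos s → Set where
  ch-root : ∀ {n c} (i : Fin n) → IsChild {sh n c} (sub i (rootOf (c i))) root
  ch-sub  : ∀ {n c} (i : Fin n) {b a : SPos (c i)} →
            IsChild b a → IsChild {sh n c} (sub i b) (sub i a)

module _ {Σl : Set} where

  record IsTopEmb {S : Shape} {T : Tree Σl} (ψ : SPos S → Pos T) : Set where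
    field
      injective  : ∀ x y → ψ x ≡ ψ y → x ≡ y
      descendant : ∀ a b → IsChild b a → ψ a ≼ ψ b
      disjoint   : ∀ a b c → IsChild b a → IsChild c a → b ≢ c →
                   ∀ w → ψ a ≼ w → w ≼ ψ b → w ≼ ψ c → w ≡ ψ a

  record CSE (T T' : Tree Σl) : Set where
    field
      S    : Shape
      ψ    : SPos S → Pos T
      ψ'   : SPos S → Pos T'
      emb  : IsTopEmb ψ
      emb' : IsTopEmb ψ'

module _ (G : OrderedAbelianGroup) {Σl : Set}
         (ω : Σl → Σl → Ext G) (p : Pen G) where

  -- weight of a pair of topological paths of lengths k and l whose last
  -- edges have labels x and y
  pathW : ℕ → ℕ → Maybe Σl → Maybe Σl → Ext G
  pathW (suc zero) (suc zero) (just x) (just y) = ω x y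
  pathW (suc zero) (suc zero) _        _        = -∞   -- unreachable
  pathW k          l          _        _        = negPen G p ((k +ℕ l) ∸ 2)

  topPathW : ∀ {T T' : Tree Σl} → Pos T → Pos T → Pos T' → Pos T' → Ext G
  topPathW x y x' y' =
    pathW (depth y ∸ depth x) (depth y' ∸ depth x') (inEdge y) (inEdge y')

  weightS : ∀ {T T' : Tree Σl} (S : Shape) →
            (SPos S → Pos T) → (SPos S → Pos T') → Ext G
  weightS (sh n c) ψ ψ' =
    _⊕_ G (ω (vlab (ψ root)) (vlab (ψ' root)))
      (sumF G n (λ i →
        _⊕_ G (topPathW (ψ root) (ψ (sub i (rootOf (c i)))) (ψ' root) (ψ' (sub i (rootOf (c i)))))
              (weightS (c i) (ψ ∘ sub i) (ψ' ∘ sub i))))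

  weight : ∀ {T T' : Tree Σl} → CSE T T' → Ext G
  weight φ = weightS (CSE.S φ) (CSE.ψ φ) (CSE.ψ' φ)

  RootToRoot : ∀ {T T' : Tree Σl} → CSE T T' → Set
  RootToRoot {T} {T'} φ =
    Σ (SPos (CSE.S φ)) λ s → (CSE.ψ φ s ≡ top T) × (CSE.ψ' φ s ≡ top T')

  Skips : ∀ {T T' : Tree Σl} → CSE T T' → Set
  Skips {T} {T'} φ =
    ¬ ((CSE.ψ φ (rootOf (CSE.S φ)) ≡ top T) × (CSE.ψ' φ (rootOf (CSE.S φ)) ≡ top T'))

  IsLrr : Tree Σl → Tree Σl → Ext G → Set
  IsLrr T T' = IsMax G (λ x → Σ (CSE T T') λ φ → RootToRoot φ × (weight φ ≡ x))

  IsLsk : Tree Σl → Tree Σl → Ext G → Set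
  IsLsk T T' = IsMax G (λ x → Σ (CSE T T') λ φ → Skips φ ×
    (_⊕_ G (weight φ)
      (negPen G p (depth (CSE.ψ φ (rootOf (CSE.S φ))) +ℕ depth (CSE.ψ' φ (rootOf (CSE.S φ))))) ≡ x))

-- Matchings in the complete bipartite graph Fin n ⊔ Fin m: encoded as a
-- partial injection f (edge i–j in the matching iff f i ≡ just j).

record Matching (n m : ℕ) : Set where
  field
    f   : Fin n → Maybe (Fin m)
    inj : ∀ i i' j → f i ≡ just j → f i' ≡ just j → i ≡ i'

module _ (G : OrderedAbelianGroup) where

  matchW : ∀ {n m} → (Fin n → Fin m → Ext G) → Matching n m → Ext G
  matchW {n} w M = sumF G n (λ i → edgeW i (Matching.f M i))
    where
    edgeW : _ → Maybe _ → Ext G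
    edgeW i nothing  = fin (OrderedAbelianGroup.0# G)
    edgeW i (just j) = w i j

  IsMaxWeightMatching : ∀ {n m} → (Fin n → Fin m → Ext G) → Matching n m → Set
  IsMaxWeightMatching w M = ∀ M' → _≤E_ G (matchW w M') (matchW w M)

{-# OPTIONS --safe #-}
module Submission where

-- A CSE between T_u and T'_v that skips u or v has its top pair inside T_b for a child b of u
-- (or inside T'_c for a child c of v), and is a CSE of T_b and T'_v lifted at the cost of one
-- more skipped vertex; lifting is weight-preserving and reversible, which gives the sk equation.
-- A root-to-root CSE splits at the root into CSEs between distinct child subtrees T_b, T'_c
-- (distinct by the disjoint-paths condition), each together with the topological path leading
-- into it contributing at most w(bc): L(b,c,sk) if it skips, L(b,c,rr) + ω(ub,vc) otherwise.
-- The pairs (b,c) form a matching of G, and conversely optimal CSEs along any matching join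
-- into a root-to-root CSE, which gives the rr equation.

open import Defs
open import Data.Nat using (ℕ; zero; suc; _∸_) renaming (_+_ to _+ℕ_)
open import Data.Nat.Properties using (0∸n≡0; +-suc)
open import Data.Fin using (Fin; zero; suc)
open import Data.Fin.Properties using (_≟_; suc-injective)
open import Data.Maybe using (Maybe; just; nothing)
open import Data.Maybe.Properties using (just-injective)
open import Data.Product using (Σ-syntax; _×_; _,_; proj₁; proj₂)
open import Data.Sum using (_⊎_; inj₁; inj₂)
open import Data.Empty using (⊥-elim)
open import Relation.Binary.PropositionalEquality
open import Relation.Nullary using (¬_; Dec; yes; no)
open import Function using (_∘_)
open import Algebra.Bundles using (AbelianGroup)
import Algebra.Consequences.Propositional as Consequences
open import Relation.Binary.Bundles using (Poset)
import Relation.Binary.Reasoning.PartialOrder as PosetReasoning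

any⊎all : ∀ {k} {A B : Fin k → Set} → (∀ t → A t ⊎ B t) → (Σ[ t ∈ Fin k ] A t) ⊎ (∀ t → B t)
any⊎all {zero}  h = inj₂ λ ()
any⊎all {suc k} h with h zero | any⊎all (h ∘ suc)
... | inj₁ a₀ | _              = inj₁ (zero , a₀)
... | inj₂ _  | inj₁ (t , aₜ)  = inj₁ (suc t , aₜ)
... | inj₂ b₀ | inj₂ b         = inj₂ λ { zero → b₀ ; (suc t) → b t }

module ExtendedArithmetic (G : OrderedAbelianGroup) where
  open OrderedAbelianGroup G

  +-abelianGroup : AbelianGroup _ _
  +-abelianGroup = record
    { Carrier = R ; _≈_ = _≡_ ; _∙_ = _+_ ; ε = 0# ; _⁻¹ = -_
    ; isAbelianGroup = record
      { isGroup = record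
        { isMonoid = record
          { isSemigroup = record
            { isMagma = record { isEquivalence = isEquivalence ; ∙-cong = cong₂ _+_ }
            ; assoc = +-assoc }
          ; identity = Consequences.comm∧idˡ⇒id +-comm +-identityˡ }
        ; inverse = Consequences.comm∧invˡ⇒inv +-comm -‿inverseˡ
        ; ⁻¹-cong = cong -_ }
      ; comm = +-comm } }

  open import Algebra.Properties.AbelianGroup +-abelianGroup using (⁻¹-∙-comm; ε⁻¹≈ε)

  ×R-distribʳ-+ : ∀ m n q → _×R_ G (m +ℕ n) q ≡ _×R_ G m q + _×R_ G n q
  ×R-distribʳ-+ zero    n q = sym (+-identityˡ _)
  ×R-distribʳ-+ (suc m) n q = trans (cong (q +_) (×R-distribʳ-+ m n q)) (sym (+-assoc q _ _))

  E : Set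
  E = Ext G

  infixl 6 _⊞_
  _⊞_ : E → E → E
  _⊞_ = _⊕_ G

  infix 4 _≤ₑ_
  _≤ₑ_ : E → E → Set
  _≤ₑ_ = _≤E_ G

  ⊞-comm : ∀ x y → x ⊞ y ≡ y ⊞ x
  ⊞-comm -∞      -∞      = refl
  ⊞-comm -∞      (fin y) = refl
  ⊞-comm (fin x) -∞      = refl
  ⊞-comm (fin x) (fin y) = cong fin (+-comm x y)

  ⊞-assoc : ∀ x y z → (x ⊞ y) ⊞ z ≡ x ⊞ (y ⊞ z)
  ⊞-assoc -∞      y       z       = refl
  ⊞-assoc (fin x) -∞      z       = refl
  ⊞-assoc (fin x) (fin y) -∞      = refl
  ⊞-assoc (fin x) (fin y) (fin z) = cong fin (+-assoc x y z)

  ⊞-identityˡ : ∀ x → fin 0# ⊞ x ≡ x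
  ⊞-identityˡ -∞      = refl
  ⊞-identityˡ (fin x) = cong fin (+-identityˡ x)

  ⊞-identityʳ : ∀ x → x ⊞ fin 0# ≡ x
  ⊞-identityʳ x = trans (⊞-comm x _) (⊞-identityˡ x)

  ⊞-zeroʳ : ∀ x → x ⊞ -∞ ≡ -∞
  ⊞-zeroʳ -∞      = refl
  ⊞-zeroʳ (fin x) = refl

  ≤ₑ-refl : ∀ {x} → x ≤ₑ x
  ≤ₑ-refl { -∞}   = -∞≤
  ≤ₑ-refl {fin x} = fin≤ ≤-refl

  ≤ₑ-reflexive : ∀ {x y} → x ≡ y → x ≤ₑ y
  ≤ₑ-reflexive refl = ≤ₑ-refl

  ≤ₑ-trans : ∀ {x y z} → x ≤ₑ y → y ≤ₑ z → x ≤ₑ z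
  ≤ₑ-trans -∞≤      _        = -∞≤
  ≤ₑ-trans (fin≤ p) (fin≤ q) = fin≤ (≤-trans p q)

  ≤ₑ-antisym : ∀ {x y} → x ≤ₑ y → y ≤ₑ x → x ≡ y
  ≤ₑ-antisym -∞≤      -∞≤      = refl
  ≤ₑ-antisym (fin≤ p) (fin≤ q) = cong fin (≤-antisym p q)

  ≤ₑ-poset : Poset _ _ _
  ≤ₑ-poset = record
    { Carrier = E ; _≈_ = _≡_ ; _≤_ = _≤ₑ_
    ; isPartialOrder = record
      { isPreorder = record { isEquivalence = isEquivalence ; reflexive = ≤ₑ-reflexive ; trans = ≤ₑ-trans }
      ; antisym = ≤ₑ-antisym } }

  module ≤ₑ-Reasoning = PosetReasoning ≤ₑ-poset

  ⊞-mono-≤ₑ : ∀ {x x' y y'} → x ≤ₑ x' → y ≤ₑ y' → x ⊞ y ≤ₑ x' ⊞ y'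
  ⊞-mono-≤ₑ -∞≤      _        = -∞≤
  ⊞-mono-≤ₑ (fin≤ p) -∞≤      = -∞≤
  ⊞-mono-≤ₑ {fin x} {fin x'} {fin y} {fin y'} (fin≤ p) (fin≤ q) =
    fin≤ (≤-trans (+-monoˡ-≤ y p) (subst₂ _≤_ (+-comm y x') (+-comm y' x') (+-monoˡ-≤ x' q)))

  maxE-upperˡ : ∀ x y → x ≤ₑ maxE G x y
  maxE-upperˡ -∞      y       = -∞≤
  maxE-upperˡ (fin x) -∞      = ≤ₑ-refl
  maxE-upperˡ (fin x) (fin y) with ≤-total x y
  ... | inj₁ x≤y = fin≤ x≤y
  ... | inj₂ _   = ≤ₑ-refl

  maxE-upperʳ : ∀ x y → y ≤ₑ maxE G x y
  maxE-upperʳ -∞      y       = ≤ₑ-refl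
  maxE-upperʳ (fin x) -∞      = -∞≤
  maxE-upperʳ (fin x) (fin y) with ≤-total x y
  ... | inj₁ _   = ≤ₑ-refl
  ... | inj₂ y≤x = fin≤ y≤x

  maxE-sel : ∀ x y → (maxE G x y ≡ x) ⊎ (maxE G x y ≡ y)
  maxE-sel -∞      y       = inj₂ refl
  maxE-sel (fin x) -∞      = inj₁ refl
  maxE-sel (fin x) (fin y) with ≤-total x y
  ... | inj₁ _ = inj₂ refl
  ... | inj₂ _ = inj₁ refl

  maxE-⊞-least : ∀ {x y z m} → x ⊞ z ≤ₑ m → y ⊞ z ≤ₑ m → maxE G x y ⊞ z ≤ₑ m
  maxE-⊞-least {x} {y} p q with maxE-sel x y
  ... | inj₁ eq rewrite eq = p
  ... | inj₂ eq rewrite eq = q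

  maxF-upper : ∀ n (f : Fin n → E) i → f i ≤ₑ maxF G n f
  maxF-upper (suc n) f zero    = maxE-upperˡ _ _
  maxF-upper (suc n) f (suc i) = ≤ₑ-trans (maxF-upper n (f ∘ suc) i) (maxE-upperʳ (f zero) _)

  maxF-sel : ∀ n (f : Fin n → E) → (maxF G n f ≡ -∞) ⊎ (Σ[ i ∈ Fin n ] maxF G n f ≡ f i)
  maxF-sel zero    f = inj₁ refl
  maxF-sel (suc n) f with maxE-sel (f zero) (maxF G n (f ∘ suc))
  ... | inj₁ eq = inj₂ (zero , eq)
  ... | inj₂ eq with maxF-sel n (f ∘ suc)
  ...   | inj₁ eq'       = inj₁ (trans eq eq')
  ...   | inj₂ (i , eq') = inj₂ (suc i , trans eq eq')

  maxF-⊞-least : ∀ n (f : Fin n → E) {z m} → (∀ i → f i ⊞ z ≤ₑ m) → maxF G n f ⊞ z ≤ₑ m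
  maxF-⊞-least n f h with maxF-sel n f
  ... | inj₁ eq       rewrite eq = -∞≤
  ... | inj₂ (i , eq) rewrite eq = h i

  sumF-cong : ∀ n {f g : Fin n → E} → (∀ i → f i ≡ g i) → sumF G n f ≡ sumF G n g
  sumF-cong zero    h = refl
  sumF-cong (suc n) h = cong₂ _⊞_ (h zero) (sumF-cong n (h ∘ suc))

  sumF-mono-≤ₑ : ∀ n {f g : Fin n → E} → (∀ i → f i ≤ₑ g i) → sumF G n f ≤ₑ sumF G n g
  sumF-mono-≤ₑ zero    h = ≤ₑ-refl
  sumF-mono-≤ₑ (suc n) h = ⊞-mono-≤ₑ (h zero) (sumF-mono-≤ₑ n (h ∘ suc))

  sumF-∞ : ∀ n (f : Fin n → E) i → f i ≡ -∞ → sumF G n f ≡ -∞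
  sumF-∞ (suc n) f zero    eq rewrite eq = refl
  sumF-∞ (suc n) f (suc i) eq rewrite sumF-∞ n (f ∘ suc) i eq = ⊞-zeroʳ (f zero)

  sumF-identity : ∀ n → sumF G n (λ _ → fin 0#) ≡ fin 0#
  sumF-identity zero    = refl
  sumF-identity (suc n) = trans (cong (fin 0# ⊞_) (sumF-identity n)) (⊞-identityˡ _)

  sumF-update : ∀ n (g g' : Fin n → E) i₀ → (∀ i → i ≢ i₀ → g' i ≡ g i) → g i₀ ≡ fin 0# →
                sumF G n g' ≡ g' i₀ ⊞ sumF G n g
  sumF-update (suc n) g g' zero h g₀ = cong (g' zero ⊞_) (begin
    sumF G n (g' ∘ suc)           ≡⟨ sumF-cong n (λ i → h (suc i) (λ ())) ⟩
    sumF G n (g ∘ suc)            ≡⟨ sym (⊞-identityˡ _) ⟩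
    fin 0# ⊞ sumF G n (g ∘ suc)   ≡⟨ cong (_⊞ sumF G n (g ∘ suc)) (sym g₀) ⟩
    g zero ⊞ sumF G n (g ∘ suc)   ∎)
    where open ≡-Reasoning
  sumF-update (suc n) g g' (suc i₀) h g₀ = begin
    g' zero ⊞ sumF G n (g' ∘ suc)
      ≡⟨ cong₂ _⊞_ (h zero (λ ()))
                   (sumF-update n (g ∘ suc) (g' ∘ suc) i₀ (λ i i≢i₀ → h (suc i) (i≢i₀ ∘ suc-injective)) g₀) ⟩
    g zero ⊞ (g' (suc i₀) ⊞ sumF G n (g ∘ suc))
      ≡⟨ sym (⊞-assoc (g zero) _ _) ⟩
    (g zero ⊞ g' (suc i₀)) ⊞ sumF G n (g ∘ suc)
      ≡⟨ cong (_⊞ sumF G n (g ∘ suc)) (⊞-comm (g zero) _) ⟩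
    (g' (suc i₀) ⊞ g zero) ⊞ sumF G n (g ∘ suc)
      ≡⟨ ⊞-assoc _ _ _ ⟩
    g' (suc i₀) ⊞ (g zero ⊞ sumF G n (g ∘ suc)) ∎
    where open ≡-Reasoning

  negPen-+ : ∀ p m n → negPen G p (m +ℕ n) ≡ negPen G p m ⊞ negPen G p n
  negPen-+ ∞         zero    zero    = cong fin (sym (+-identityˡ 0#))
  negPen-+ ∞         zero    (suc n) = refl
  negPen-+ ∞         (suc m) n       = refl
  negPen-+ (fin q _) m       n       =
    cong fin (trans (cong -_ (×R-distribʳ-+ m n q)) (sym (⁻¹-∙-comm _ _)))

  negPen-suc : ∀ p d → negPen G p (suc d) ≡ negPen G p d ⊞ negPen G p 1
  negPen-suc p d = trans (negPen-+ p 1 d) (⊞-comm _ _)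

  negPen-0 : ∀ p → negPen G p 0 ≡ fin 0#
  negPen-0 ∞         = refl
  negPen-0 (fin q _) = cong fin ε⁻¹≈ε

  IsMax-elim : ∀ {P m} (Q : E → Set) → IsMax G P m → Q -∞ → (∀ x → P x → Q x) → Q m
  IsMax-elim Q (_ , inj₁ Pm)          _   Q-attained = Q-attained _ Pm
  IsMax-elim Q (_ , inj₂ (refl , _)) Q-∞ _          = Q-∞

  IsMax-attained : ∀ {P m} → IsMax G P m → (m ≡ -∞) ⊎ P m
  IsMax-attained {P} max = IsMax-elim (λ x → (x ≡ -∞) ⊎ P x) max (inj₁ refl) (λ _ → inj₂)

module Matchings (G : OrderedAbelianGroup) where
  open OrderedAbelianGroup G using (0#)
  open ExtendedArithmetic G

  edgeWeight : ∀ {n m} → (Fin n → Fin m → E) → Fin n → Maybe (Fin m) → E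
  edgeWeight w i nothing  = fin 0#
  edgeWeight w i (just j) = w i j

  matchW-≡ : ∀ {n m} (w : Fin n → Fin m → E) (M : Matching n m) →
             matchW G w M ≡ sumF G n (λ i → edgeWeight w i (Matching.f M i))
  matchW-≡ {n} w M = trans (sym (proj₂ summands)) (sumF-cong n summands-≡)
    where
    -- the edge weight used by matchW is local to its definition; this Σ gives access to it
    summands : Σ[ F ∈ (Fin n → E) ] sumF G n F ≡ matchW G w M
    summands = _ , refl
    summands-≡ : ∀ i → proj₁ summands i ≡ edgeWeight w i (Matching.f M i)
    summands-≡ i with Matching.f M i
    ... | nothing = refl
    ... | just j  = refl

  edgeWeight-suc : ∀ {n m} (w : Fin (suc n) → Fin m → E) i x →
                   edgeWeight w (suc i) x ≡ edgeWeight (w ∘ suc) i x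
  edgeWeight-suc w i nothing  = refl
  edgeWeight-suc w i (just j) = refl

  record Support {n m} (f : Fin n → Maybe (Fin m)) : Set where
    field
      k              : ℕ
      left           : Fin k → Fin n
      right          : Fin k → Fin m
      left-injective : ∀ t t' → left t ≡ left t' → t ≡ t'
      f-left         : ∀ t → f (left t) ≡ just (right t)
      sumF-support   : ∀ w → sumF G n (λ i → edgeWeight w i (f i)) ≡ sumF G k (λ t → w (left t) (right t))

  support : ∀ n {m} (f : Fin n → Maybe (Fin m)) → Support f
  support zero    f = record
    { k = zero ; left = λ () ; right = λ () ; left-injective = λ () ; f-left = λ () ; sumF-support = λ _ → refl }
  support (suc n) f = extend (f zero) refl
    where
    module S = Support (support n (f ∘ suc))
    tail-≡ : ∀ w → sumF G n (λ i → edgeWeight w (suc i) (f (suc i))) ≡ sumF G S.k (λ t → w (suc (S.left t)) (S.right t))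
    tail-≡ w = trans (sumF-cong n (λ i → edgeWeight-suc w i (f (suc i)))) (S.sumF-support (w ∘ suc))
    extend : ∀ x → f zero ≡ x → Support f
    extend nothing f₀ = record
      { k = S.k ; left = suc ∘ S.left ; right = S.right
      ; left-injective = λ t t' eq → S.left-injective t t' (suc-injective eq)
      ; f-left = S.f-left
      ; sumF-support = λ w → trans (cong (λ x → edgeWeight w zero x ⊞ sumF G n (λ i → edgeWeight w (suc i) (f (suc i)))) f₀)
                                   (trans (⊞-identityˡ _) (tail-≡ w)) }
    extend (just j) f₀ = record
      { k = suc S.k ; left = left ; right = right ; left-injective = left-injective ; f-left = f-left
      ; sumF-support = λ w → cong₂ _⊞_ (cong (edgeWeight w zero) f₀) (tail-≡ w) }
      where
      left : Fin (suc S.k) → Fin (suc n)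
      left zero    = zero
      left (suc t) = suc (S.left t)
      right : Fin (suc S.k) → _
      right zero    = j
      right (suc t) = S.right t
      left-injective : ∀ t t' → left t ≡ left t' → t ≡ t'
      left-injective zero    zero     _  = refl
      left-injective (suc t) (suc t') eq = cong suc (S.left-injective t t' (suc-injective eq))
      f-left : ∀ t → f (left t) ≡ just (right t)
      f-left zero    = f₀
      f-left (suc t) = S.f-left t

  record Realisation {n m} k (left : Fin k → Fin n) (right : Fin k → Fin m) : Set where
    field
      f            : Fin n → Maybe (Fin m)
      f-inverse    : ∀ i j → f i ≡ just j → Σ[ t ∈ Fin k ] left t ≡ i × right t ≡ j
      sumF-realised : ∀ w → sumF G n (λ i → edgeWeight w i (f i)) ≡ sumF G k (λ t → w (left t) (right t))

  realise : ∀ {n m} k (left : Fin k → Fin n) (right : Fin k → Fin m) →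
            (∀ t t' → left t ≡ left t' → t ≡ t') → Realisation k left right
  realise {n} zero left right _ = record
    { f = λ _ → nothing ; f-inverse = λ _ _ () ; sumF-realised = λ _ → sumF-identity n }
  realise {n} {m} (suc k) left right left-inj = record
    { f = f ; f-inverse = f-inverse ; sumF-realised = sumF-realised }
    where
    module R = Realisation (realise k (left ∘ suc) (right ∘ suc) (λ t t' → suc-injective ∘ left-inj _ _))
    i₀ = left zero
    select : ∀ i → Dec (i ≡ i₀) → Maybe (Fin m)
    select i (yes _) = just (right zero)
    select i (no _)  = R.f i
    f : Fin n → Maybe (Fin m)
    f i = select i (i ≟ i₀)
    f-i₀ : f i₀ ≡ just (right zero)
    f-i₀ with i₀ ≟ i₀
    ... | yes _   = refl
    ... | no i₀≢i₀ = ⊥-elim (i₀≢i₀ refl)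
    f-other : ∀ i → i ≢ i₀ → f i ≡ R.f i
    f-other i i≢i₀ with i ≟ i₀
    ... | yes i≡i₀ = ⊥-elim (i≢i₀ i≡i₀)
    ... | no _     = refl
    f-inverse : ∀ i j → f i ≡ just j → Σ[ t ∈ Fin (suc k) ] left t ≡ i × right t ≡ j
    f-inverse i j fi≡j with i ≟ i₀
    ... | yes i≡i₀ = zero , sym i≡i₀ , just-injective fi≡j
    ... | no _ with R.f-inverse i j fi≡j
    ...   | t , eqˡ , eqʳ = suc t , eqˡ , eqʳ
    R-i₀ : R.f i₀ ≡ nothing
    R-i₀ with R.f i₀ in eq
    ... | nothing = refl
    ... | just j with R.f-inverse i₀ j eq
    ...   | t , eqˡ , _ with left-inj (suc t) zero eqˡ
    ...     | ()
    sumF-realised : ∀ w → sumF G n (λ i → edgeWeight w i (f i)) ≡ w i₀ (right zero) ⊞ sumF G k (λ t → w (left (suc t)) (right (suc t)))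
    sumF-realised w =
      trans (sumF-update n (λ i → edgeWeight w i (R.f i)) (λ i → edgeWeight w i (f i)) i₀
                         (λ i i≢i₀ → cong (edgeWeight w i) (f-other i i≢i₀)) (cong (edgeWeight w i₀) R-i₀))
            (cong₂ _⊞_ (cong (edgeWeight w i₀) f-i₀) (R.sumF-realised w))

  record EdgeFamily n m : Set where
    field
      k               : ℕ
      left            : Fin k → Fin n
      right           : Fin k → Fin m
      left-injective  : ∀ t t' → left t ≡ left t' → t ≡ t'
      right-injective : ∀ t t' → right t ≡ right t' → t ≡ t'

  familyW : ∀ {n m} → (Fin n → Fin m → E) → EdgeFamily n m → E
  familyW w F = sumF G k (λ t → w (left t) (right t))
    where open EdgeFamily F

  edgesOf : ∀ {n m} → Matching n m → EdgeFamily n m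
  edgesOf {n} M = record
    { k = k ; left = left ; right = right ; left-injective = left-injective
    ; right-injective = λ t t' eq →
        left-injective t t' (Matching.inj M (left t) (left t') (right t) (f-left t) (trans (f-left t') (cong just (sym eq)))) }
    where open Support (support n (Matching.f M))

  matchW-edgesOf : ∀ {n m} (w : Fin n → Fin m → E) (M : Matching n m) → matchW G w M ≡ familyW w (edgesOf M)
  matchW-edgesOf {n} w M = trans (matchW-≡ w M) (Support.sumF-support (support n (Matching.f M)) w)

  matchingOf : ∀ {n m} → EdgeFamily n m → Matching n m
  matchingOf F = record { f = f ; inj = inj }
    where
    open EdgeFamily F
    open Realisation (realise k left right left-injective)
    inj : ∀ i i' j → f i ≡ just j → f i' ≡ just j → i ≡ i'
    inj i i' j fi≡j fi'≡j with f-inverse i j fi≡j | f-inverse i' j fi'≡j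
    ... | t , eqˡ , eqʳ | t' , eqˡ' , eqʳ' with right-injective t t' (trans eqʳ (sym eqʳ'))
    ... | refl = trans (sym eqˡ) eqˡ'

  matchW-matchingOf : ∀ {n m} (w : Fin n → Fin m → E) (F : EdgeFamily n m) → matchW G w (matchingOf F) ≡ familyW w F
  matchW-matchingOf w F = trans (matchW-≡ w (matchingOf F)) (sumF-realised w)
    where open EdgeFamily F
          open Realisation (realise k left right left-injective)

module TreePositions {Σl : Set} where

  ≼-refl : ∀ {t} (q : Pos {Σl} t) → q ≼ q
  ≼-refl here        = ≼-here
  ≼-refl (there i q) = ≼-there i (≼-refl q)

  ≼-trans : ∀ {t} {x y z : Pos {Σl} t} → x ≼ y → y ≼ z → x ≼ z
  ≼-trans ≼-here        _              = ≼-here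
  ≼-trans (≼-there i p) (≼-there .i q) = ≼-there i (≼-trans p q)

  top-≼ : ∀ t (q : Pos {Σl} t) → top t ≼ q
  top-≼ (node _ _ _ _) q = ≼-here

  ≼-top⇒≡top : ∀ {t} {q : Pos {Σl} t} → q ≼ top t → q ≡ top t
  ≼-top⇒≡top {node _ _ _ _} ≼-here = refl

  ≡top? : ∀ {t} (q : Pos {Σl} t) → Dec (q ≡ top t)
  ≡top? here        = yes refl
  ≡top? (there i q) = no (λ ())

  ≡top⇒depth≡0 : ∀ {t} (q : Pos {Σl} t) → q ≡ top t → depth q ≡ 0
  ≡top⇒depth≡0 {node _ _ _ _} .here refl = refl

  depth≡0⇒≡top : ∀ {t} (q : Pos {Σl} t) → depth q ≡ 0 → q ≡ top t
  depth≡0⇒≡top here _ = refl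

  ≡top⇒inEdge≡nothing : ∀ {t} (q : Pos {Σl} t) → q ≡ top t → inEdge q ≡ nothing
  ≡top⇒inEdge≡nothing {node _ _ _ _} .here refl = refl

  module _ {a : Σl} {n : ℕ} {e : Fin n → Σl} {c : Fin n → Tree Σl} where
    private
      T : Tree Σl
      T = node a n e c

    there-injective : ∀ {i} {p q : Pos (c i)} → _≡_ {A = Pos T} (there i p) (there i q) → p ≡ q
    there-injective refl = refl

    there-injectiveˡ : ∀ {i j} {p : Pos (c i)} {q : Pos (c j)} → _≡_ {A = Pos T} (there i p) (there j q) → i ≡ j
    there-injectiveˡ refl = refl

    ≼-there⁻¹ : ∀ {i} {p q : Pos (c i)} → _≼_ {t = T} (there i p) (there i q) → p ≼ q
    ≼-there⁻¹ (≼-there _ p≼q) = p≼q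

    ≼-there-index : ∀ {i j} {p : Pos (c i)} {q : Pos (c j)} → _≼_ {t = T} (there i p) (there j q) → i ≡ j
    ≼-there-index (≼-there _ _) = refl

    ≼-there-image : ∀ {i} {q : Pos (c i)} {y : Pos T} → there i q ≼ y → Σ[ y' ∈ Pos (c i) ] y ≡ there i y'
    ≼-there-image (≼-there _ {q = y'} _) = y' , refl

    ≢top⇒there : (q : Pos T) → q ≢ here → Σ[ i ∈ Fin n ] Σ[ q' ∈ Pos (c i) ] q ≡ there i q'
    ≢top⇒there here        q≢here = ⊥-elim (q≢here refl)
    ≢top⇒there (there i q) _      = i , q , refl

    inEdge-there-top : ∀ i (q : Pos (c i)) → q ≡ top (c i) → inEdge {t = T} (there i q) ≡ just (e i)
    inEdge-there-top i q q≡top rewrite ≡top⇒inEdge≡nothing q q≡top = refl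

    inEdge-there : ∀ i (q : Pos (c i)) → (depth q ≡ 0) ⊎ (inEdge {t = T} (there i q) ≡ inEdge q)
    inEdge-there i q with inEdge q in eq
    ... | just x  = inj₂ refl
    ... | nothing = inj₁ (inEdge≡nothing⇒depth≡0 q eq)
      where
      inEdge≡nothing⇒depth≡0 : ∀ {t} (q : Pos t) → inEdge q ≡ nothing → depth q ≡ 0
      inEdge≡nothing⇒depth≡0 here eq = refl
      inEdge≡nothing⇒depth≡0 (there i q) eq with inEdge q
      inEdge≡nothing⇒depth≡0 (there i q) () | nothing
      inEdge≡nothing⇒depth≡0 (there i q) () | just _

module TopologicalEmbeddings {Σl : Set} where
  open TreePositions {Σl}
  open IsTopEmb

  sub-injective : ∀ {n cs} {j : Fin n} {x y : SPos (cs j)} → _≡_ {A = SPos (sh n cs)} (sub j x) (sub j y) → x ≡ y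
  sub-injective refl = refl

  sub-injectiveˡ : ∀ {k cs} {t t' : Fin k} {x : SPos (cs t)} {y : SPos (cs t')} →
                   _≡_ {A = SPos (sh k cs)} (sub t x) (sub t' y) → t ≡ t'
  sub-injectiveˡ refl = refl

  IsTopEmb-≗ : ∀ {S} {T : Tree Σl} {χ χ' : SPos S → Pos T} → IsTopEmb χ → (∀ s → χ s ≡ χ' s) → IsTopEmb χ'
  IsTopEmb-≗ {χ = χ} {χ'} E χ≗χ' = record
    { injective  = λ x y eq → injective E x y (trans (χ≗χ' x) (trans eq (sym (χ≗χ' y))))
    ; descendant = λ a b b<a → subst₂ _≼_ (χ≗χ' a) (χ≗χ' b) (descendant E a b b<a)
    ; disjoint   = λ a b c b<a c<a b≢c w a≼w w≼b w≼c →
        trans (disjoint E a b c b<a c<a b≢c w (subst (_≼ w) (sym (χ≗χ' a)) a≼w)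
                 (subst (w ≼_) (sym (χ≗χ' b)) w≼b) (subst (w ≼_) (sym (χ≗χ' c)) w≼c))
              (χ≗χ' a) }

  restrict : ∀ {T : Tree Σl} {n cs} (j : Fin n) {χ : SPos (sh n cs) → Pos T} → IsTopEmb χ → IsTopEmb (χ ∘ sub j)
  restrict j E = record
    { injective  = λ x y eq → sub-injective (injective E (sub j x) (sub j y) eq)
    ; descendant = λ a b b<a → descendant E (sub j a) (sub j b) (ch-sub j b<a)
    ; disjoint   = λ a b c b<a c<a b≢c → disjoint E (sub j a) (sub j b) (sub j c)
                     (ch-sub j b<a) (ch-sub j c<a) (b≢c ∘ sub-injective) }

  root-≼ : ∀ {T : Tree Σl} S {χ : SPos S → Pos T} → IsTopEmb χ → ∀ s → χ (rootOf S) ≼ χ s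
  root-≼ (sh n cs) E root      = ≼-refl _
  root-≼ (sh n cs) E (sub j s) = ≼-trans (descendant E root (sub j (rootOf (cs j))) (ch-root j)) (root-≼ (cs j) (restrict j E) s)

  ≡top⇒root : ∀ {T : Tree Σl} {S} {χ : SPos S → Pos T} → IsTopEmb χ → ∀ s → χ s ≡ top T →
              (rootOf S ≡ s) × (χ (rootOf S) ≡ top T)
  ≡top⇒root {T} {S} {χ} E s χs≡top = injective E _ _ (trans root↦top (sym χs≡top)) , root↦top
    where
    root↦top : χ (rootOf S) ≡ top T
    root↦top = ≼-top⇒≡top (subst (χ (rootOf S) ≼_) χs≡top (root-≼ S E s))

  module _ {a : Σl} {n : ℕ} {e : Fin n → Σl} {c : Fin n → Tree Σl} {S : Shape} (i : Fin n) where
    private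
      T : Tree Σl
      T = node a n e c

    there-emb : {χ : SPos S → Pos (c i)} → IsTopEmb χ → IsTopEmb {T = T} (there i ∘ χ)
    there-emb {χ} E = record
      { injective  = λ x y eq → injective E x y (there-injective eq)
      ; descendant = λ a b b<a → ≼-there i (descendant E a b b<a)
      ; disjoint   = there-disjoint }
      where
      there-disjoint : ∀ a b c → IsChild b a → IsChild c a → b ≢ c → ∀ w →
                       there i (χ a) ≼ w → w ≼ there i (χ b) → w ≼ there i (χ c) → w ≡ there i (χ a)
      there-disjoint a b c b<a c<a b≢c .(there i _) (≼-there .i a≼w) w≼b w≼c =
        cong (there i) (disjoint E a b c b<a c<a b≢c _ a≼w (≼-there⁻¹ w≼b) (≼-there⁻¹ w≼c))

    there-emb⁻¹ : {χ : SPos S → Pos (c i)} → IsTopEmb {T = T} (there i ∘ χ) → IsTopEmb χ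
    there-emb⁻¹ E = record
      { injective  = λ x y eq → injective E x y (cong (there i) eq)
      ; descendant = λ a b b<a → ≼-there⁻¹ (descendant E a b b<a)
      ; disjoint   = λ a b c b<a c<a b≢c w a≼w w≼b w≼c →
          there-injective (disjoint E a b c b<a c<a b≢c (there i w) (≼-there i a≼w) (≼-there i w≼b) (≼-there i w≼c)) }

    below-child : {χ : SPos S → Pos T} → IsTopEmb χ → {q : Pos (c i)} → χ (rootOf S) ≡ there i q →
                  Σ[ χ' ∈ (SPos S → Pos (c i)) ] IsTopEmb χ' × (∀ s → χ s ≡ there i (χ' s))
    below-child {χ} E {q} root↦q = χ' , there-emb⁻¹ (IsTopEmb-≗ E factor) , factor
      where
      image : ∀ s → Σ[ y ∈ Pos (c i) ] χ s ≡ there i y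
      image s = ≼-there-image (subst (_≼ χ s) root↦q (root-≼ S E s))
      χ' : SPos S → Pos (c i)
      χ' = proj₁ ∘ image
      factor : ∀ s → χ s ≡ there i (χ' s)
      factor = proj₂ ∘ image

  module _ {a : Σl} {n : ℕ} {e : Fin n → Σl} {c : Fin n → Tree Σl} where
    private
      T : Tree Σl
      T = node a n e c

    -- two children of the root entering the same child subtree would share its top vertex, against disjointness
    child-index-injective : ∀ {k cs} {ψ : SPos (sh k cs) → Pos T} → IsTopEmb ψ → ψ root ≡ here →
                            (b : Fin k → Fin n) (q : ∀ t → Pos (c (b t))) →
                            (∀ t → ψ (sub t (rootOf (cs t))) ≡ there (b t) (q t)) → ∀ t t' → b t ≡ b t' → t ≡ t'
    child-index-injective {cs = cs} {ψ} E root↦top b q ψ-child t t' bt≡bt' with t ≟ t'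
    ... | yes t≡t' = t≡t'
    ... | no t≢t' with trans meet root↦top
      where
      entry : Pos T
      entry = there (b t) (top (c (b t)))
      entry≼ : ∀ {j} (b≡j : b t ≡ j) (y : Pos (c j)) → entry ≼ there j y
      entry≼ refl y = ≼-there _ (top-≼ _ y)
      meet : entry ≡ ψ root
      meet = disjoint E root (sub t (rootOf (cs t))) (sub t' (rootOf (cs t'))) (ch-root t) (ch-root t')
               (t≢t' ∘ sub-injectiveˡ) entry (subst (_≼ entry) (sym root↦top) ≼-here)
               (subst (entry ≼_) (sym (ψ-child t)) (entry≼ refl (q t)))
               (subst (entry ≼_) (sym (ψ-child t')) (entry≼ bt≡bt' (q t')))
    ... | ()

    module Join (k : ℕ) (b : Fin k → Fin n) (b-injective : ∀ t t' → b t ≡ b t' → t ≡ t')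
                (Ss : Fin k → Shape) (χ : ∀ t → SPos (Ss t) → Pos (c (b t))) (E : ∀ t → IsTopEmb (χ t)) where

      join : SPos (sh k Ss) → Pos T
      join root      = here
      join (sub t x) = there (b t) (χ t x)

      join-injective : ∀ x y → join x ≡ join y → x ≡ y
      join-injective root      root       _  = refl
      join-injective (sub t x) (sub t' y) eq with b-injective t t' (there-injectiveˡ eq)
      ... | refl = cong (sub t) (injective (E t) x y (there-injective eq))

      join-descendant : ∀ x y → IsChild y x → join x ≼ join y
      join-descendant .root      .(sub t _) (ch-root t)          = ≼-here
      join-descendant .(sub t _) .(sub t _) (ch-sub t {y} {x} y<x) = ≼-there (b t) (descendant (E t) x y y<x)

      join-disjoint : ∀ x y z → IsChild y x → IsChild z x → y ≢ z →
                      ∀ w → join x ≼ w → w ≼ join y → w ≼ join z → w ≡ join x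
      join-disjoint .root _ _ (ch-root t) (ch-root t') y≢z here _ _ _ = refl
      join-disjoint .root _ _ (ch-root t) (ch-root t') y≢z (there i w) _ w≼y w≼z
        with b-injective t t' (trans (sym (≼-there-index w≼y)) (≼-there-index w≼z))
      ... | refl = ⊥-elim (y≢z refl)
      join-disjoint .(sub t _) .(sub t _) .(sub t _) (ch-sub t {y} {x} y<x) (ch-sub .t {z} z<x) y≢z
                    .(there (b t) _) (≼-there _ x≼w) w≼y w≼z =
        cong (there (b t)) (disjoint (E t) x y z y<x z<x (y≢z ∘ cong (sub t)) _ x≼w (≼-there⁻¹ w≼y) (≼-there⁻¹ w≼z))

      join-emb : IsTopEmb join
      join-emb = record { injective = join-injective ; descendant = join-descendant ; disjoint = join-disjoint }

    record ChildDecomposition {k cs} (ψ : SPos (sh k cs) → Pos T) : Set where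
      field
        index           : Fin k → Fin n
        index-injective : ∀ t t' → index t ≡ index t' → t ≡ t'
        below           : ∀ t → SPos (cs t) → Pos (c (index t))
        below-emb       : ∀ t → IsTopEmb (below t)
        ψ-below         : ∀ t s → ψ (sub t s) ≡ there (index t) (below t s)

    decompose : ∀ {k cs} {ψ : SPos (sh k cs) → Pos T} → IsTopEmb ψ → ψ root ≡ here → ChildDecomposition ψ
    decompose {k} {cs} {ψ} E root↦top = record
      { index = index ; index-injective = child-index-injective E root↦top index entry ψ-entry
      ; below = λ t → proj₁ (split t) ; below-emb = λ t → proj₁ (proj₂ (split t)) ; ψ-below = λ t → proj₂ (proj₂ (split t)) }
      where
      child-not-top : ∀ t → ψ (sub t (rootOf (cs t))) ≢ here
      child-not-top t eq with injective E root (sub t (rootOf (cs t))) (trans root↦top (sym eq))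
      ... | ()
      child : ∀ t → Σ[ i ∈ Fin n ] Σ[ q ∈ Pos (c i) ] ψ (sub t (rootOf (cs t))) ≡ there i q
      child t = ≢top⇒there _ (child-not-top t)
      index : Fin k → Fin n
      index = proj₁ ∘ child
      entry : ∀ t → Pos (c (index t))
      entry t = proj₁ (proj₂ (child t))
      ψ-entry : ∀ t → ψ (sub t (rootOf (cs t))) ≡ there (index t) (entry t)
      ψ-entry t = proj₂ (proj₂ (child t))
      split : ∀ t → Σ[ χ ∈ (SPos (cs t) → Pos (c (index t))) ] IsTopEmb χ × (∀ s → ψ (sub t s) ≡ there (index t) (χ s))
      split t = below-child (index t) (restrict t E) (ψ-entry t)

module EmbeddingWeights (G : OrderedAbelianGroup) {Σl : Set} (ω : Σl → Σl → Ext G) (p : Pen G) where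
  open ExtendedArithmetic G
  open TreePositions {Σl}

  pathW-cong-labels : ∀ k l {x x' y y'} → (k ≡ 0 ⊎ x ≡ x') → (l ≡ 0 ⊎ y ≡ y') →
                      pathW G ω p k l x y ≡ pathW G ω p k l x' y'
  pathW-cong-labels zero          l    _           _           = refl
  pathW-cong-labels (suc k)       l    (inj₂ refl) (inj₂ refl) = refl
  pathW-cong-labels (suc zero)    zero (inj₂ refl) (inj₁ refl) = refl
  pathW-cong-labels (suc (suc k)) zero (inj₂ refl) (inj₁ refl) = refl

  pathW-long : ∀ k l {x y} → ¬ (k ≡ 0 × l ≡ 0) → pathW G ω p (suc k) (suc l) x y ≡ negPen G p (k +ℕ l)
  pathW-long zero    zero    k,l≢0 = ⊥-elim (k,l≢0 (refl , refl))
  pathW-long zero    (suc l) _     = refl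
  pathW-long (suc k) l       _     = cong (negPen G p) (+-suc k l)

  topPathW-cong : ∀ {T T' : Tree Σl} {x₁ x₂ y₁ y₂ : Pos T} {x₁' x₂' y₁' y₂' : Pos T'} →
                  x₁ ≡ x₂ → y₁ ≡ y₂ → x₁' ≡ x₂' → y₁' ≡ y₂' → topPathW G ω p x₁ y₁ x₁' y₁' ≡ topPathW G ω p x₂ y₂ x₂' y₂'
  topPathW-cong refl refl refl refl = refl

  weightS-cong : ∀ {T T' : Tree Σl} S {ψ₁ ψ₂ : SPos S → Pos T} {ψ₁' ψ₂' : SPos S → Pos T'} →
                 (∀ s → ψ₁ s ≡ ψ₂ s) → (∀ s → ψ₁' s ≡ ψ₂' s) → weightS G ω p S ψ₁ ψ₁' ≡ weightS G ω p S ψ₂ ψ₂'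
  weightS-cong (sh n cs) h h' =
    cong₂ _⊞_ (cong₂ ω (cong vlab (h root)) (cong vlab (h' root)))
      (sumF-cong n (λ j → cong₂ _⊞_ (topPathW-cong (h root) (h (sub j _)) (h' root) (h' (sub j _)))
                                    (weightS-cong (cs j) (h ∘ sub j) (h' ∘ sub j))))

  module _ {a : Σl} {n : ℕ} {e : Fin n → Σl} {c : Fin n → Tree Σl} (i : Fin n) where
    private
      T : Tree Σl
      T = node a n e c

    -- pathW reads only the label of a path's last edge, which lifting into T preserves unless the path is empty
    inEdge-there-path : (x y : Pos (c i)) → (depth y ∸ depth x ≡ 0) ⊎ (inEdge {t = T} (there i y) ≡ inEdge y)
    inEdge-there-path x y with inEdge-there {a = a} {e = e} {c = c} i y
    ... | inj₁ depth≡0 = inj₁ (trans (cong (_∸ depth x) depth≡0) (0∸n≡0 (depth x)))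
    ... | inj₂ eq      = inj₂ eq

    weightS-thereˡ : ∀ {T' : Tree Σl} S (χ : SPos S → Pos (c i)) (χ' : SPos S → Pos T') →
                     weightS G ω p {T = T} S (there i ∘ χ) χ' ≡ weightS G ω p S χ χ'
    weightS-thereˡ (sh m cs) χ χ' = cong (ω (vlab (χ root)) (vlab (χ' root)) ⊞_) (sumF-cong m λ j →
      cong₂ _⊞_ (pathW-cong-labels _ _ (inEdge-there-path (χ root) (χ (sub j (rootOf (cs j))))) (inj₂ refl))
                (weightS-thereˡ (cs j) (χ ∘ sub j) (χ' ∘ sub j)))

    weightS-thereʳ : ∀ {T' : Tree Σl} S (χ' : SPos S → Pos T') (χ : SPos S → Pos (c i)) →
                     weightS G ω p {T' = T} S χ' (there i ∘ χ) ≡ weightS G ω p S χ' χ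
    weightS-thereʳ (sh m cs) χ' χ = cong (ω (vlab (χ' root)) (vlab (χ root)) ⊞_) (sumF-cong m λ j →
      cong₂ _⊞_ (pathW-cong-labels (depth (χ' (sub j (rootOf (cs j)))) ∸ depth (χ' root)) _
                                   (inj₂ refl) (inEdge-there-path (χ root) (χ (sub j (rootOf (cs j))))))
                (weightS-thereʳ (cs j) (χ' ∘ sub j) (χ ∘ sub j)))

  module Children (a : Σl) (n : ℕ) (e : Fin n → Σl) (c : Fin n → Tree Σl)
                  (a' : Σl) (n' : ℕ) (e' : Fin n' → Σl) (c' : Fin n' → Tree Σl) where
    private
      T T' : Tree Σl
      T  = node a n e c
      T' = node a' n' e' c'

    childPathW-top : ∀ i j (q : Pos (c i)) (q' : Pos (c' j)) → q ≡ top (c i) → q' ≡ top (c' j) →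
                     topPathW G ω p {T} {T'} here (there i q) here (there j q') ≡ ω (e i) (e' j)
    childPathW-top i j q q' q≡top q'≡top = begin
      pathW G ω p (suc (depth q)) (suc (depth q')) ℓ ℓ'
        ≡⟨ cong₂ (λ k l → pathW G ω p (suc k) (suc l) ℓ ℓ') (≡top⇒depth≡0 q q≡top) (≡top⇒depth≡0 q' q'≡top) ⟩
      pathW G ω p 1 1 ℓ ℓ'
        ≡⟨ cong₂ (pathW G ω p 1 1) (inEdge-there-top {a = a} {c = c} i q q≡top) (inEdge-there-top {a = a'} {c = c'} j q' q'≡top) ⟩
      ω (e i) (e' j) ∎
      where
      open ≡-Reasoning
      ℓ ℓ' : Maybe Σl
      ℓ  = inEdge {t = T} (there i q)
      ℓ' = inEdge {t = T'} (there j q')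

    childPathW-skip : ∀ i j (q : Pos (c i)) (q' : Pos (c' j)) → ¬ (q ≡ top (c i) × q' ≡ top (c' j)) →
                      topPathW G ω p {T} {T'} here (there i q) here (there j q') ≡ negPen G p (depth q +ℕ depth q')
    childPathW-skip i j q q' not-top =
      pathW-long (depth q) (depth q') λ (d≡0 , d'≡0) → not-top (depth≡0⇒≡top q d≡0 , depth≡0⇒≡top q' d'≡0)

    childW : ∀ i j S → (SPos S → Pos (c i)) → (SPos S → Pos (c' j)) → Ext G
    childW i j S χ χ' = topPathW G ω p {T} {T'} here (there i (χ (rootOf S))) here (there j (χ' (rootOf S))) ⊞ weightS G ω p S χ χ'

    weightS-children : ∀ {k cs} {ψ : SPos (sh k cs) → Pos T} {ψ' : SPos (sh k cs) → Pos T'} →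
                       ψ root ≡ here → ψ' root ≡ here →
                       (b : Fin k → Fin n) (χ : ∀ t → SPos (cs t) → Pos (c (b t))) → (∀ t s → ψ (sub t s) ≡ there (b t) (χ t s)) →
                       (d : Fin k → Fin n') (χ' : ∀ t → SPos (cs t) → Pos (c' (d t))) → (∀ t s → ψ' (sub t s) ≡ there (d t) (χ' t s)) →
                       weightS G ω p (sh k cs) ψ ψ' ≡ ω a a' ⊞ sumF G k (λ t → childW (b t) (d t) (cs t) (χ t) (χ' t))
    weightS-children {k} {cs} {ψ} {ψ'} root↦top root↦top' b χ ψ≗χ d χ' ψ'≗χ' =
      cong₂ _⊞_ (cong₂ ω (cong vlab root↦top) (cong vlab root↦top')) (sumF-cong k λ t →
        cong₂ _⊞_ (topPathW-cong root↦top (ψ≗χ t _) root↦top' (ψ'≗χ' t _)) (begin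
          weightS G ω p (cs t) (ψ ∘ sub t) (ψ' ∘ sub t)                 ≡⟨ weightS-cong (cs t) (ψ≗χ t) (ψ'≗χ' t) ⟩
          weightS G ω p (cs t) (there (b t) ∘ χ t) (there (d t) ∘ χ' t) ≡⟨ weightS-thereˡ (b t) (cs t) (χ t) _ ⟩
          weightS G ω p (cs t) (χ t) (there (d t) ∘ χ' t)               ≡⟨ weightS-thereʳ (d t) (cs t) (χ t) (χ' t) ⟩
          weightS G ω p (cs t) (χ t) (χ' t)                             ∎))
      where open ≡-Reasoning

module TableRecurrence (G : OrderedAbelianGroup) {Σl : Set} (ω : Σl → Σl → Ext G) (p : Pen G)
    (Lrr Lsk : Tree Σl → Tree Σl → Ext G)
    (isLrr : ∀ A B → IsLrr G ω p A B (Lrr A B))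
    (isLsk : ∀ A B → IsLsk G ω p A B (Lsk A B)) where
  open ExtendedArithmetic G
  open Matchings G
  open TreePositions {Σl}
  open TopologicalEmbeddings {Σl}
  open EmbeddingWeights G ω p
  open CSE

  cse : ∀ {A B : Tree Σl} S {χ : SPos S → Pos A} {χ' : SPos S → Pos B} → IsTopEmb χ → IsTopEmb χ' → CSE A B
  cse S {χ} {χ'} E E' = record { S = S ; ψ = χ ; ψ' = χ' ; emb = E ; emb' = E' }

  -- the quantity maximised by L(u, v, sk)
  penalisedW : ∀ {A B : Tree Σl} S → (SPos S → Pos A) → (SPos S → Pos B) → E
  penalisedW S χ χ' = weightS G ω p S χ χ' ⊞ negPen G p (depth (χ (rootOf S)) +ℕ depth (χ' (rootOf S)))

  penalisedW-cong : ∀ {A B : Tree Σl} S {χ₁ χ₂ : SPos S → Pos A} {χ₁' χ₂' : SPos S → Pos B} →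
                    (∀ s → χ₁ s ≡ χ₂ s) → (∀ s → χ₁' s ≡ χ₂' s) → penalisedW S χ₁ χ₁' ≡ penalisedW S χ₂ χ₂'
  penalisedW-cong S h h' = cong₂ _⊞_ (weightS-cong S h h')
    (cong₂ (λ x y → negPen G p (depth x +ℕ depth y)) (h (rootOf S)) (h' (rootOf S)))

  penalisedᶜ : ∀ {A B : Tree Σl} → CSE A B → E
  penalisedᶜ φ = penalisedW (S φ) (ψ φ) (ψ' φ)

  penalisedᶜ-rootToRoot : ∀ {A B : Tree Σl} (φ : CSE A B) → RootToRoot G ω p φ → penalisedᶜ φ ≡ weight G ω p φ
  penalisedᶜ-rootToRoot φ (s , s↦top , s↦top') = begin
    weight G ω p φ ⊞ negPen G p (depth (ψ φ (rootOf (S φ))) +ℕ depth (ψ' φ (rootOf (S φ))))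
      ≡⟨ cong₂ (λ d d' → weight G ω p φ ⊞ negPen G p (d +ℕ d'))
               (≡top⇒depth≡0 _ (proj₂ (≡top⇒root (emb φ) s s↦top))) (≡top⇒depth≡0 _ (proj₂ (≡top⇒root (emb' φ) s s↦top'))) ⟩
    weight G ω p φ ⊞ negPen G p 0  ≡⟨ cong (weight G ω p φ ⊞_) (negPen-0 p) ⟩
    weight G ω p φ ⊞ fin _         ≡⟨ ⊞-identityʳ _ ⟩
    weight G ω p φ                 ∎
    where open ≡-Reasoning

  penalisedᶜ-≤ : ∀ {A B : Tree Σl} (φ : CSE A B) {m} → Lrr A B ≤ₑ m → Lsk A B ≤ₑ m → penalisedᶜ φ ≤ₑ m
  penalisedᶜ-≤ {A} {B} φ Lrr≤m Lsk≤m with ≡top? (ψ φ (rootOf (S φ))) | ≡top? (ψ' φ (rootOf (S φ)))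
  ... | yes root↦top | yes root↦top' =
    ≤ₑ-trans (≤ₑ-reflexive (penalisedᶜ-rootToRoot φ rootToRoot)) (≤ₑ-trans (proj₁ (isLrr A B) _ (φ , rootToRoot , refl)) Lrr≤m)
    where rootToRoot = rootOf (S φ) , root↦top , root↦top'
  ... | no skip | _ = ≤ₑ-trans (proj₁ (isLsk A B) _ (φ , skip ∘ proj₁ , refl)) Lsk≤m
  ... | yes _ | no skip = ≤ₑ-trans (proj₁ (isLsk A B) _ (φ , skip ∘ proj₂ , refl)) Lsk≤m

  tables-⊞-≤ : ∀ {A B : Tree Σl} {z m} → (∀ (φ : CSE A B) → penalisedᶜ φ ⊞ z ≤ₑ m) → (Lsk A B ⊞ z ≤ₑ m) × (Lrr A B ⊞ z ≤ₑ m)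
  tables-⊞-≤ {A} {B} {z} {m} h =
    IsMax-elim (λ x → x ⊞ z ≤ₑ m) (isLsk A B) -∞≤ (λ { x (φ , _ , refl) → h φ }) ,
    IsMax-elim (λ x → x ⊞ z ≤ₑ m) (isLrr A B) -∞≤ (λ { x (φ , rootToRoot , refl) → subst (λ y → y ⊞ z ≤ₑ _) (penalisedᶜ-rootToRoot φ rootToRoot) (h φ) })

  module _ {a : Σl} {n : ℕ} {e : Fin n → Σl} {c : Fin n → Tree Σl} (i : Fin n) {B : Tree Σl} where
    private
      T : Tree Σl
      T = node a n e c

    liftˡ : CSE (c i) B → CSE T B
    liftˡ φ = cse (S φ) (there-emb i (emb φ)) (emb' φ)

    liftˡ-skips : (φ : CSE (c i) B) → Skips G ω p (liftˡ φ)
    liftˡ-skips φ (() , _)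

    penalisedᶜ-liftˡ : (φ : CSE (c i) B) → penalisedᶜ (liftˡ φ) ≡ penalisedᶜ φ ⊞ negPen G p 1
    penalisedᶜ-liftˡ φ = begin
      weightS G ω p (S φ) (there i ∘ ψ φ) (ψ' φ) ⊞ negPen G p (suc d +ℕ d')
        ≡⟨ cong (_⊞ negPen G p (suc d +ℕ d')) (weightS-thereˡ i (S φ) (ψ φ) (ψ' φ)) ⟩
      weight G ω p φ ⊞ negPen G p (suc (d +ℕ d'))
        ≡⟨ cong (weight G ω p φ ⊞_) (negPen-suc p (d +ℕ d')) ⟩
      weight G ω p φ ⊞ (negPen G p (d +ℕ d') ⊞ negPen G p 1)
        ≡⟨ sym (⊞-assoc _ _ _) ⟩
      penalisedᶜ φ ⊞ negPen G p 1 ∎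
      where
      open ≡-Reasoning
      d d' : ℕ
      d  = depth (ψ φ (rootOf (S φ)))
      d' = depth (ψ' φ (rootOf (S φ)))

  module _ {a : Σl} {n : ℕ} {e : Fin n → Σl} {c : Fin n → Tree Σl} (j : Fin n) {A : Tree Σl} where
    private
      T : Tree Σl
      T = node a n e c

    liftʳ : CSE A (c j) → CSE A T
    liftʳ φ = cse (S φ) (emb φ) (there-emb j (emb' φ))

    liftʳ-skips : (φ : CSE A (c j)) → Skips G ω p (liftʳ φ)
    liftʳ-skips φ (_ , ())

    penalisedᶜ-liftʳ : (φ : CSE A (c j)) → penalisedᶜ (liftʳ φ) ≡ penalisedᶜ φ ⊞ negPen G p 1
    penalisedᶜ-liftʳ φ = begin
      weightS G ω p (S φ) (ψ φ) (there j ∘ ψ' φ) ⊞ negPen G p (d +ℕ suc d')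
        ≡⟨ cong₂ (λ x k → x ⊞ negPen G p k) (weightS-thereʳ j (S φ) (ψ φ) (ψ' φ)) (+-suc d d') ⟩
      weight G ω p φ ⊞ negPen G p (suc (d +ℕ d'))
        ≡⟨ cong (weight G ω p φ ⊞_) (negPen-suc p (d +ℕ d')) ⟩
      weight G ω p φ ⊞ (negPen G p (d +ℕ d') ⊞ negPen G p 1)
        ≡⟨ sym (⊞-assoc _ _ _) ⟩
      penalisedᶜ φ ⊞ negPen G p 1 ∎
      where
      open ≡-Reasoning
      d d' : ℕ
      d  = depth (ψ φ (rootOf (S φ)))
      d' = depth (ψ' φ (rootOf (S φ)))

  module AtRoots (a : Σl) (n : ℕ) (e : Fin n → Σl) (c : Fin n → Tree Σl)
                 (a' : Σl) (n' : ℕ) (e' : Fin n' → Σl) (c' : Fin n' → Tree Σl) where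
    open Children a n e c a' n' e' c'

    T T' : Tree Σl
    T  = node a n e c
    T' = node a' n' e' c'

    MTsk MTrr MT'sk MT'rr Mchildren Mskip : E
    MTsk  = maxF G n (λ i → Lsk (c i) T')
    MTrr  = maxF G n (λ i → Lrr (c i) T')
    MT'sk = maxF G n' (λ j → Lsk T (c' j))
    MT'rr = maxF G n' (λ j → Lrr T (c' j))
    Mchildren = maxE G (maxE G MTsk MTrr) (maxE G MT'sk MT'rr)
    Mskip     = Mchildren ⊞ negPen G p 1

    Lrr-child-≤ˡ : ∀ i → Lrr (c i) T' ≤ₑ Mchildren
    Lrr-child-≤ˡ i = ≤ₑ-trans (maxF-upper n _ i) (≤ₑ-trans (maxE-upperʳ MTsk MTrr) (maxE-upperˡ _ _))

    Lsk-child-≤ˡ : ∀ i → Lsk (c i) T' ≤ₑ Mchildren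
    Lsk-child-≤ˡ i = ≤ₑ-trans (maxF-upper n _ i) (≤ₑ-trans (maxE-upperˡ MTsk MTrr) (maxE-upperˡ _ _))

    Lrr-child-≤ʳ : ∀ j → Lrr T (c' j) ≤ₑ Mchildren
    Lrr-child-≤ʳ j = ≤ₑ-trans (maxF-upper n' _ j) (≤ₑ-trans (maxE-upperʳ MT'sk MT'rr) (maxE-upperʳ (maxE G MTsk MTrr) _))

    Lsk-child-≤ʳ : ∀ j → Lsk T (c' j) ≤ₑ Mchildren
    Lsk-child-≤ʳ j = ≤ₑ-trans (maxF-upper n' _ j) (≤ₑ-trans (maxE-upperˡ MT'sk MT'rr) (maxE-upperʳ (maxE G MTsk MTrr) _))

    belowˡ-≤ : (φ : CSE T T') {i : Fin n} {q : Pos (c i)} → ψ φ (rootOf (S φ)) ≡ there i q → penalisedᶜ φ ≤ₑ Mskip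
    belowˡ-≤ φ {i} root↦ with below-child i (emb φ) root↦
    ... | χ , Eχ , ψ≗χ = begin
      penalisedᶜ φ                      ≡⟨ penalisedW-cong (S φ) ψ≗χ (λ _ → refl) ⟩
      penalisedᶜ (liftˡ {c = c} i φ₀)   ≡⟨ penalisedᶜ-liftˡ {c = c} i φ₀ ⟩
      penalisedᶜ φ₀ ⊞ negPen G p 1       ≤⟨ ⊞-mono-≤ₑ (penalisedᶜ-≤ φ₀ (Lrr-child-≤ˡ i) (Lsk-child-≤ˡ i)) ≤ₑ-refl ⟩
      Mskip                              ∎
      where
      open ≤ₑ-Reasoning
      φ₀ = cse (S φ) Eχ (emb' φ)

    belowʳ-≤ : (φ : CSE T T') {j : Fin n'} {q : Pos (c' j)} → ψ' φ (rootOf (S φ)) ≡ there j q → penalisedᶜ φ ≤ₑ Mskip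
    belowʳ-≤ φ {j} root↦ with below-child j (emb' φ) root↦
    ... | χ' , Eχ' , ψ'≗χ' = begin
      penalisedᶜ φ                      ≡⟨ penalisedW-cong (S φ) (λ _ → refl) ψ'≗χ' ⟩
      penalisedᶜ (liftʳ {c = c'} j φ₀)  ≡⟨ penalisedᶜ-liftʳ {c = c'} j φ₀ ⟩
      penalisedᶜ φ₀ ⊞ negPen G p 1       ≤⟨ ⊞-mono-≤ₑ (penalisedᶜ-≤ φ₀ (Lrr-child-≤ʳ j) (Lsk-child-≤ʳ j)) ≤ₑ-refl ⟩
      Mskip                              ∎
      where
      open ≤ₑ-Reasoning
      φ₀ = cse (S φ) (emb φ) Eχ'

    skipping-≤ : (φ : CSE T T') → Skips G ω p φ → penalisedᶜ φ ≤ₑ Mskip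
    skipping-≤ φ skip = by-top-pair (ψ φ (rootOf (S φ))) refl (ψ' φ (rootOf (S φ))) refl
      where
      by-top-pair : ∀ x → ψ φ (rootOf (S φ)) ≡ x → ∀ y → ψ' φ (rootOf (S φ)) ≡ y → penalisedᶜ φ ≤ₑ Mskip
      by-top-pair here        root↦ here         root↦' = ⊥-elim (skip (root↦ , root↦'))
      by-top-pair (there i q) root↦ _            _      = belowˡ-≤ φ root↦
      by-top-pair here        _     (there j q') root↦' = belowʳ-≤ φ root↦'

    Lsk-≤ : Lsk T T' ≤ₑ Mskip
    Lsk-≤ = IsMax-elim (_≤ₑ Mskip) (isLsk T T') -∞≤ λ { x (φ , skip , refl) → skipping-≤ φ skip }

    ≤-Lsk : Mskip ≤ₑ Lsk T T'
    ≤-Lsk = maxE-⊞-least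
      (maxE-⊞-least (maxF-⊞-least n _ (λ i → proj₁ (tables-⊞-≤ (liftedˡ-≤ i))))
                    (maxF-⊞-least n _ (λ i → proj₂ (tables-⊞-≤ (liftedˡ-≤ i)))))
      (maxE-⊞-least (maxF-⊞-least n' _ (λ j → proj₁ (tables-⊞-≤ (liftedʳ-≤ j))))
                    (maxF-⊞-least n' _ (λ j → proj₂ (tables-⊞-≤ (liftedʳ-≤ j)))))
      where
      liftedˡ-≤ : ∀ i (φ : CSE (c i) T') → penalisedᶜ φ ⊞ negPen G p 1 ≤ₑ Lsk T T'
      liftedˡ-≤ i φ = proj₁ (isLsk T T') _ (liftˡ {c = c} i φ , liftˡ-skips {c = c} i φ , penalisedᶜ-liftˡ {c = c} i φ)
      liftedʳ-≤ : ∀ j (φ : CSE T (c' j)) → penalisedᶜ φ ⊞ negPen G p 1 ≤ₑ Lsk T T'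
      liftedʳ-≤ j φ = proj₁ (isLsk T T') _ (liftʳ {c = c'} j φ , liftʳ-skips {c = c'} j φ , penalisedᶜ-liftʳ {c = c'} j φ)

    w : Fin n → Fin n' → E
    w i j = maxE G (Lsk (c i) (c' j)) (Lrr (c i) (c' j) ⊞ ω (e i) (e' j))

    childW-rootToRoot : ∀ i j S {χ : SPos S → Pos (c i)} {χ' : SPos S → Pos (c' j)} →
                        χ (rootOf S) ≡ top (c i) → χ' (rootOf S) ≡ top (c' j) →
                        childW i j S χ χ' ≡ weightS G ω p S χ χ' ⊞ ω (e i) (e' j)
    childW-rootToRoot i j S root↦top root↦top' =
      trans (cong (_⊞ _) (childPathW-top i j _ _ root↦top root↦top')) (⊞-comm _ _)

    childW-skip : ∀ i j S {χ : SPos S → Pos (c i)} {χ' : SPos S → Pos (c' j)} →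
                  ¬ (χ (rootOf S) ≡ top (c i) × χ' (rootOf S) ≡ top (c' j)) → childW i j S χ χ' ≡ penalisedW S χ χ'
    childW-skip i j S skip = trans (cong (_⊞ _) (childPathW-skip i j _ _ skip)) (⊞-comm _ _)

    skipping-childW-≤ : ∀ i j S {χ : SPos S → Pos (c i)} {χ' : SPos S → Pos (c' j)} → IsTopEmb χ → IsTopEmb χ' →
                        ¬ (χ (rootOf S) ≡ top (c i) × χ' (rootOf S) ≡ top (c' j)) → childW i j S χ χ' ≤ₑ w i j
    skipping-childW-≤ i j S {χ} {χ'} E E' skip = begin
      childW i j S χ χ'  ≡⟨ childW-skip i j S skip ⟩
      penalisedW S χ χ'  ≤⟨ proj₁ (isLsk (c i) (c' j)) _ (cse S E E' , skip , refl) ⟩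
      Lsk (c i) (c' j)   ≤⟨ maxE-upperˡ _ _ ⟩
      w i j              ∎
      where open ≤ₑ-Reasoning

    childW-≤ : ∀ i j S {χ : SPos S → Pos (c i)} {χ' : SPos S → Pos (c' j)} → IsTopEmb χ → IsTopEmb χ' → childW i j S χ χ' ≤ₑ w i j
    childW-≤ i j S {χ} {χ'} E E' with ≡top? (χ (rootOf S)) | ≡top? (χ' (rootOf S))
    ... | yes root↦top | yes root↦top' = begin
      childW i j S χ χ'                          ≡⟨ childW-rootToRoot i j S root↦top root↦top' ⟩
      weightS G ω p S χ χ' ⊞ ω (e i) (e' j)      ≤⟨ ⊞-mono-≤ₑ (proj₁ (isLrr (c i) (c' j)) _ (cse S E E' , (rootOf S , root↦top , root↦top') , refl)) ≤ₑ-refl ⟩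
      Lrr (c i) (c' j) ⊞ ω (e i) (e' j)          ≤⟨ maxE-upperʳ (Lsk (c i) (c' j)) _ ⟩
      w i j                                      ∎
      where open ≤ₑ-Reasoning
    ... | no skip | _       = skipping-childW-≤ i j S E E' (skip ∘ proj₁)
    ... | yes _   | no skip = skipping-childW-≤ i j S E E' (skip ∘ proj₂)

    record AttainingPair (i : Fin n) (j : Fin n') : Set where
      field
        S      : Shape
        χ      : SPos S → Pos (c i)
        χ'     : SPos S → Pos (c' j)
        χ-emb  : IsTopEmb χ
        χ'-emb : IsTopEmb χ'
        childW≡w : childW i j S χ χ' ≡ w i j

    w-attained : ∀ i j → (w i j ≡ -∞) ⊎ AttainingPair i j
    w-attained i j with maxE-sel (Lsk (c i) (c' j)) (Lrr (c i) (c' j) ⊞ ω (e i) (e' j))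
    ... | inj₁ w≡sk with IsMax-attained (isLsk (c i) (c' j))
    ...   | inj₁ sk≡-∞ = inj₁ (trans w≡sk sk≡-∞)
    ...   | inj₂ (φ , skip , sk≡) = inj₂ record
      { S = S φ ; χ = ψ φ ; χ' = ψ' φ ; χ-emb = emb φ ; χ'-emb = emb' φ
      ; childW≡w = trans (childW-skip i j (S φ) skip) (trans sk≡ (sym w≡sk)) }
    w-attained i j | inj₂ w≡rr with IsMax-attained (isLrr (c i) (c' j))
    ...   | inj₁ rr≡-∞ = inj₁ (trans w≡rr (cong (_⊞ ω (e i) (e' j)) rr≡-∞))
    ...   | inj₂ (φ , (s , s↦top , s↦top') , rr≡) = inj₂ record
      { S = S φ ; χ = ψ φ ; χ' = ψ' φ ; χ-emb = emb φ ; χ'-emb = emb' φ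
      ; childW≡w = trans (childW-rootToRoot i j (S φ) (proj₂ (≡top⇒root (emb φ) s s↦top)) (proj₂ (≡top⇒root (emb' φ) s s↦top')))
                         (trans (cong (_⊞ ω (e i) (e' j)) rr≡) (sym w≡rr)) }

    module _ (M : Matching n n') (M-max : IsMaxWeightMatching G w M) where

      rootToRoot-≤ : ∀ S {ψ : SPos S → Pos T} {ψ' : SPos S → Pos T'} → IsTopEmb ψ → IsTopEmb ψ' →
                     ψ (rootOf S) ≡ here → ψ' (rootOf S) ≡ here → weightS G ω p S ψ ψ' ≤ₑ ω a a' ⊞ matchW G w M
      rootToRoot-≤ (sh k cs) {ψ} {ψ'} E E' root↦top root↦top' = begin
        weightS G ω p (sh k cs) ψ ψ'
          ≡⟨ weightS-children {ψ = ψ} {ψ' = ψ'} root↦top root↦top' D.index D.below D.ψ-below D'.index D'.below D'.ψ-below ⟩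
        ω a a' ⊞ sumF G k (λ t → childW (D.index t) (D'.index t) (cs t) (D.below t) (D'.below t))
          ≤⟨ ⊞-mono-≤ₑ ≤ₑ-refl (sumF-mono-≤ₑ k λ t → childW-≤ (D.index t) (D'.index t) (cs t) (D.below-emb t) (D'.below-emb t)) ⟩
        ω a a' ⊞ familyW w F
          ≡⟨ cong (ω a a' ⊞_) (sym (matchW-matchingOf w F)) ⟩
        ω a a' ⊞ matchW G w (matchingOf F)
          ≤⟨ ⊞-mono-≤ₑ ≤ₑ-refl (M-max (matchingOf F)) ⟩
        ω a a' ⊞ matchW G w M ∎
        where
        open ≤ₑ-Reasoning
        module D  = ChildDecomposition (decompose E root↦top)
        module D' = ChildDecomposition (decompose E' root↦top')
        F : EdgeFamily n n'
        F = record { k = k ; left = D.index ; right = D'.index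
                   ; left-injective = D.index-injective ; right-injective = D'.index-injective }

      Lrr-≤ : Lrr T T' ≤ₑ ω a a' ⊞ matchW G w M
      Lrr-≤ = IsMax-elim (_≤ₑ ω a a' ⊞ matchW G w M) (isLrr T T') -∞≤ λ { x (φ , (s , s↦top , s↦top') , refl) →
        rootToRoot-≤ (S φ) (emb φ) (emb' φ) (proj₂ (≡top⇒root (emb φ) s s↦top)) (proj₂ (≡top⇒root (emb' φ) s s↦top')) }

    module _ (F : EdgeFamily n n') where
      open EdgeFamily F

      family-≤-Lrr : ω a a' ⊞ familyW w F ≤ₑ Lrr T T'
      family-≤-Lrr with any⊎all (λ t → w-attained (left t) (right t))
      ... | inj₁ (t , w≡-∞) =
        subst (_≤ₑ Lrr T T') (sym (trans (cong (ω a a' ⊞_) (sumF-∞ k _ t w≡-∞)) (⊞-zeroʳ _))) -∞≤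
      ... | inj₂ pair = proj₁ (isLrr T T') _ (cse (sh k Ss) L.join-emb R.join-emb , (root , refl , refl) , weight≡)
        where
        open AttainingPair
        Ss : Fin k → Shape
        Ss = S ∘ pair
        module L = Join {a = a} {e = e} {c = c} k left left-injective Ss (χ ∘ pair) (χ-emb ∘ pair)
        module R = Join {a = a'} {e = e'} {c = c'} k right right-injective Ss (χ' ∘ pair) (χ'-emb ∘ pair)
        weight≡ : weightS G ω p (sh k Ss) L.join R.join ≡ ω a a' ⊞ familyW w F
        weight≡ = trans (weightS-children {ψ = L.join} {ψ' = R.join} refl refl
                           left (χ ∘ pair) (λ _ _ → refl) right (χ' ∘ pair) (λ _ _ → refl))
                        (cong (ω a a' ⊞_) (sumF-cong k (childW≡w ∘ pair)))

    ≤-Lrr : (M : Matching n n') → ω a a' ⊞ matchW G w M ≤ₑ Lrr T T'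
    ≤-Lrr M = subst (λ x → ω a a' ⊞ x ≤ₑ Lrr T T') (sym (matchW-edgesOf w M)) (family-≤-Lrr (edgesOf M))

lemma5 : (G : OrderedAbelianGroup) {Σl : Set}
    (ω : Σl → Σl → Ext G) (p : Pen G)
    (Lrr Lsk : Tree Σl → Tree Σl → Ext G)
    → (∀ A B → IsLrr G ω p A B (Lrr A B))
    → (∀ A B → IsLsk G ω p A B (Lsk A B))
    → (a : Σl) (n : ℕ) (e : Fin n → Σl) (c : Fin n → Tree Σl)
    → (a' : Σl) (n' : ℕ) (e' : Fin n' → Σl) (c' : Fin n' → Tree Σl)
    → let T = node a n e c
          T' = node a' n' e' c'
          MTsk = maxF G n (λ i → Lsk (c i) T')
          MTrr = maxF G n (λ i → Lrr (c i) T')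
          MT'sk = maxF G n' (λ j → Lsk T (c' j))
          MT'rr = maxF G n' (λ j → Lrr T (c' j))
          w = λ (i : Fin n) (j : Fin n') →
                maxE G (Lsk (c i) (c' j)) (_⊕_ G (Lrr (c i) (c' j)) (ω (e i) (e' j)))
      in (Lsk T T' ≡ _⊕_ G (maxE G (maxE G MTsk MTrr) (maxE G MT'sk MT'rr)) (negPen G p 1))
         × (∀ (M : Matching n n') → IsMaxWeightMatching G w M
              → Lrr T T' ≡ _⊕_ G (ω a a') (matchW G w M))
lemma5 G ω p Lrr Lsk isLrr isLsk a n e c a' n' e' c' =
  ≤ₑ-antisym Lsk-≤ ≤-Lsk , λ M M-max → ≤ₑ-antisym (Lrr-≤ M M-max) (≤-Lrr M)
  where
  open ExtendedArithmetic G using (≤ₑ-antisym)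
  open TableRecurrence G ω p Lrr Lsk isLrr isLsk
  open AtRoots a n e c a' n' e' c'
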